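{- In the game of Picaria played from the empty board with player X moving first, player X cannot win; that is, O has a strategy which guarantees that X never obtains three X-stones on a line, whatever X does.
   Context: Picaria is played on the nine nodes of a $3\times 3$ grid. Two nodes are adjacent if they are distinct neighbours horizontally, vertically or diagonally. A line is one of the eight triples of nodes forming a row, a column or one of the two main diagonals. Two players, X and O, each own three stones and alternate turns, X first. Phase 1 (placement): the mover places one of its stones on an empty node, until all six stones are on the board. Phase 2 (sliding): X starts, and the mover slides one of its own stones to an adjacent empty node. A player wins as soon as its three stones occupy a line. Play may go on forever, in which case nobody wins. -}

module Defs where

open import Data.Bool using (Bool; true; false; if_then_else_; _∧_; _∨_; not)
open import Data.Nat using (ℕ; zero; suc; _∸_; _+_; _/_; _%_; _≤ᵇ_; _<ᵇ_; _≡ᵇ_)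
open import Data.Fin using (Fin; toℕ; #_)
open import Data.Fin.Properties using (_≟_)
open import Data.List using (List; []; _∷_; concatMap; allFin; foldr; length)
open import Data.Bool.ListAction using (any)
open import Data.List.Membership.Propositional using (_∈_)
open import Data.Vec using (Vec; replicate; lookup; _[_]≔_)
open import Data.Product using (_×_; _,_; ∃)
open import Relation.Binary.PropositionalEquality using (_≡_; _≢_)
open import Relation.Nullary using (does)

data Player : Set where
  X O : Player

other : Player → Player
other X = O
other O = X

data Cell : Set where
  blank : Cell
  stone : Player → Cell

_==P_ : Player → Player → Bool
X ==P X = true
O ==P O = true
_ ==P _ = false

isBlank : Cell → Bool
isBlank blank = true
isBlank (stone _) = false

isStoneOf : Player → Cell → Bool
isStoneOf p blank = false
isStoneOf p (stone q) = p ==P q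

Node : Set
Node = Fin 9

Board : Set
Board = Vec Cell 9

emptyBoard : Board
emptyBoard = replicate 9 blank

nodes : List Node
nodes = allFin 9

row col : Node → ℕ
row i = toℕ i / 3
col i = toℕ i % 3

dist : ℕ → ℕ → ℕ
dist a b = (a ∸ b) + (b ∸ a)

adjacent : Node → Node → Bool
adjacent i j = not (does (i ≟ j)) ∧ (dist (row i) (row j) ≤ᵇ 1) ∧ (dist (col i) (col j) ≤ᵇ 1)

Line : Set
Line = Node × Node × Node

lines : List Line
lines =
  (# 0 , # 1 , # 2) ∷ (# 3 , # 4 , # 5) ∷ (# 6 , # 7 , # 8) ∷
  (# 0 , # 3 , # 6) ∷ (# 1 , # 4 , # 7) ∷ (# 2 , # 5 , # 8) ∷
  (# 0 , # 4 , # 8) ∷ (# 2 , # 4 , # 6) ∷ []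

Wins : Player → Board → Set
Wins p b = ∃ λ (l : Line) → l ∈ lines ×
  (let (i , j , k) = l in
     lookup b i ≡ stone p × lookup b j ≡ stone p × lookup b k ≡ stone p)

hasLine : Player → Board → Bool
hasLine p b = any (λ { (i , j , k) → isStoneOf p (lookup b i) ∧ isStoneOf p (lookup b j) ∧ isStoneOf p (lookup b k) }) lines

stonesOf : Player → Board → ℕ
stonesOf p b = foldr (λ i n → if isStoneOf p (lookup b i) then suc n else n) 0 nodes

placements : Player → Board → List Board
placements p b = concatMap (λ i → if isBlank (lookup b i) then (b [ i ]≔ stone p) ∷ [] else []) nodes

slides : Player → Board → List Board
slides p b = concatMap (λ i →
  if isStoneOf p (lookup b i)
  then concatMap (λ j → if adjacent i j ∧ isBlank (lookup b j)
                        then ((b [ i ]≔ blank) [ j ]≔ stone p) ∷ [] else []) nodes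
  else []) nodes

moves : Player → Board → List Board
moves p b = if stonesOf p b <ᵇ 3 then placements p b else slides p b

-- A (history-dependent) strategy: given the list of earlier boards
-- (most recent first) and the current board, choose the next board.
Strategy : Set
Strategy = List Board → Board → Board

LegalFor : Player → Strategy → Set
LegalFor p σ = ∀ (h : List Board) (b : Board) → moves p b ≢ [] → σ h b ∈ moves p b

-- game state: player to move, current board, history (earlier boards, most recent first)
State : Set
State = Player × Board × List Board

isEmpty : List Board → Bool
isEmpty [] = true
isEmpty (_ ∷ _) = false

step : Strategy → Strategy → State → State
step σX σO (p , b , h) =
  if hasLine X b ∨ hasLine O b ∨ isEmpty (moves p b)
  then (p , b , h)
  else (other p , strat p h b , b ∷ h)
  where
    strat : Player → Strategy
    strat X = σX
    strat O = σO

run : Strategy → Strategy → ℕ → State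
run σX σO zero = (X , emptyBoard , [])
run σX σO (suc n) = step σX σO (run σX σO n)

boardAt : Strategy → Strategy → ℕ → Board
boardAt σX σO n with run σX σO n
... | (_ , b , _) = b

module Submission where

-- The proof is by a finite certificate.  Call a board with O to move
-- *defended* by a set S of boards if X has no line on it and O either has a
-- move into S or the game stops there; call a board with X to move *guarded*
-- if X has no line on it and either O already has a line or every X move
-- leads to a defended board.  If every member of S is guarded and the empty
-- board lies in S, then the strategy "O moves into S whenever it can" is
-- legal, and by induction on the number of turns every state of the game is
-- in S (X to move) or defended (O to move); neither kind of board carries an
-- X line.  The theorem follows by exhibiting
-- a concrete S of 433 boards and checking the two hypotheses by evaluation.

open import Defs
open import Data.Bool using (Bool; true; false; T; not; _∧_; _∨_; if_then_else_)
open import Data.Bool.ListAction using (all; any)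
open import Data.Bool.Properties using (∨-conicalˡ; ∨-conicalʳ)
open import Data.Empty using (⊥-elim)
open import Data.List using (List; []; _∷_)
open import Data.List.Membership.Propositional using (_∈_)
open import Data.List.Relation.Unary.Any using (here; there)
import Data.List.Relation.Unary.Any as Any
import Data.List.Relation.Unary.All as All
open import Data.List.Relation.Unary.All.Properties using (all⁺)
open import Data.List.Relation.Unary.Any.Properties using (any⁺)
open import Data.Nat using (ℕ; zero; suc)
open import Data.Product using (∃; _×_; _,_; proj₁; proj₂)
open import Data.Unit using (tt)
open import Data.Vec using (Vec; []; _∷_; lookup)
open import Function using (_∘_)
open import Relation.Binary.PropositionalEquality using (_≡_; _≢_; refl)
open import Relation.Nullary using (¬_)

-- Finite sets of length-n cell vectors, as tries branching on the first cell
-- (blank / X stone / O stone).  `leaf` is the set containing the empty vector.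
data CellTrie : ℕ → Set where
  ∅    : ∀ {n} → CellTrie n
  leaf : CellTrie 0
  node : ∀ {n} → CellTrie n → CellTrie n → CellTrie n → CellTrie (suc n)

_∈ᵗ_ : ∀ {n} → Vec Cell n → CellTrie n → Bool
_ ∈ᵗ ∅ = false
[] ∈ᵗ leaf = true
(blank ∷ v) ∈ᵗ node s _ _ = v ∈ᵗ s
(stone X ∷ v) ∈ᵗ node _ s _ = v ∈ᵗ s
(stone O ∷ v) ∈ᵗ node _ _ s = v ∈ᵗ s

every : ∀ {n} → (Vec Cell n → Bool) → CellTrie n → Bool
every P ∅ = true
every P leaf = P []
every P (node s₀ s₁ s₂) = every (P ∘ (blank ∷_)) s₀ ∧ every (P ∘ (stone X ∷_)) s₁ ∧ every (P ∘ (stone O ∷_)) s₂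

every-sound : ∀ {n} (P : Vec Cell n → Bool) (S : CellTrie n) (v : Vec Cell n) →
              T (every P S) → T (v ∈ᵗ S) → T (P v)
every-sound P leaf [] ok _ = ok
every-sound P (node s₀ s₁ s₂) (blank ∷ v) ok v∈S
  with every (P ∘ (blank ∷_)) s₀ | every-sound (P ∘ (blank ∷_)) s₀ v
... | true | sound₀ = sound₀ tt v∈S
every-sound P (node s₀ s₁ s₂) (stone X ∷ v) ok v∈S
  with every (P ∘ (blank ∷_)) s₀ | every (P ∘ (stone X ∷_)) s₁ | every-sound (P ∘ (stone X ∷_)) s₁ v
... | true | true | sound₁ = sound₁ tt v∈S
every-sound P (node s₀ s₁ s₂) (stone O ∷ v) ok v∈S
  with every (P ∘ (blank ∷_)) s₀ | every (P ∘ (stone X ∷_)) s₁ | every (P ∘ (stone O ∷_)) s₂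
     | every-sound (P ∘ (stone O ∷_)) s₂ v
... | true | true | true | sound₂ = sound₂ tt v∈S

-- `prefer p d xs` is the first element of xs satisfying p; if there is none it
-- falls back to the last element of xs (or to d when xs is empty).
prefer : ∀ {A : Set} → (A → Bool) → A → List A → A
prefer p d [] = d
prefer p d (x ∷ xs) = if p x then x else prefer p x xs

prefer-∈ : ∀ {A : Set} (p : A → Bool) (d x : A) (xs : List A) → prefer p d (x ∷ xs) ∈ x ∷ xs
prefer-∈ p d x xs with p x
... | true = here refl
prefer-∈ p d x [] | false = here refl
prefer-∈ p d x (y ∷ ys) | false = there (prefer-∈ p x y ys)

prefer-sat : ∀ {A : Set} (p : A → Bool) (d : A) (xs : List A) → T (any p xs) → T (p (prefer p d xs))
prefer-sat p d (x ∷ xs) some with p x in px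
... | true rewrite px = tt
... | false = prefer-sat p x xs some

-- Projections out of verified Boolean connectives.  The left operand is
-- explicit since `_∧_` and `_∨_` compute by matching on it.
∧-left : ∀ a {b} → T (a ∧ b) → T a
∧-left true _ = tt

∧-right : ∀ a {b} → T (a ∧ b) → T b
∧-right true t = t

∨-left : ∀ a {b} → T (a ∨ b) → b ≡ false → T a
∨-left true _ _ = tt
∨-left false t refl = t

∨-right : ∀ a {b} → T (a ∨ b) → a ≡ false → T b
∨-right false t refl = t

continuing : ∀ x o e → x ∨ o ∨ e ≡ false → o ≡ false × e ≡ false
continuing x o e over = ∨-conicalˡ o e rest , ∨-conicalʳ o e rest
  where
    rest : o ∨ e ≡ false
    rest = ∨-conicalʳ x (o ∨ e) over

nonEmpty : ∀ (xs : List Board) → isEmpty xs ≡ false → xs ≢ []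
nonEmpty (_ ∷ _) _ ()

lineOfX : ∀ {u v w : Cell} → u ≡ stone X → v ≡ stone X → w ≡ stone X →
          T (isStoneOf X u ∧ isStoneOf X v ∧ isStoneOf X w)
lineOfX refl refl refl = tt

xLine : Board → Line → Bool
xLine b (i , j , k) = isStoneOf X (lookup b i) ∧ isStoneOf X (lookup b j) ∧ isStoneOf X (lookup b k)

wins⇒hasLine : ∀ b → Wins X b → T (hasLine X b)
wins⇒hasLine b (_ , l∈lines , e₁ , e₂ , e₃) = any⁺ (xLine b) (Any.map (λ { refl → lineOfX e₁ e₂ e₃ }) l∈lines)

noWin : ∀ b → T (not (hasLine X b)) → ¬ Wins X b
noWin b noLine w with hasLine X b | wins⇒hasLine b w
... | true  | _  = noLine
... | false | ()

module _ (S : CellTrie 9) where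

  oCanRecover : Board → Bool
  oCanRecover c = any (_∈ᵗ S) (moves O c) ∨ hasLine O c ∨ isEmpty (moves O c)

  defended : Board → Bool
  defended c = not (hasLine X c) ∧ oCanRecover c

  guarded : Board → Bool
  guarded b = not (hasLine X b) ∧ (hasLine O b ∨ all defended (moves X b))

module _ (σX σO : Strategy) where

  data Turn : State → State → Set where
    frozen : ∀ {p b h} → Turn (p , b , h) (p , b , h)
    xPlays : ∀ {b h} → hasLine X b ∨ hasLine O b ∨ isEmpty (moves X b) ≡ false →
             Turn (X , b , h) (O , σX h b , b ∷ h)
    oPlays : ∀ {c h} → hasLine X c ∨ hasLine O c ∨ isEmpty (moves O c) ≡ false →
             Turn (O , c , h) (X , σO h c , c ∷ h)

  turn : ∀ s → Turn s (step σX σO s)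
  turn (X , b , h) with hasLine X b ∨ hasLine O b ∨ isEmpty (moves X b) in over
  ... | true = frozen
  ... | false = xPlays over
  turn (O , c , h) with hasLine X c ∨ hasLine O c ∨ isEmpty (moves O c) in over
  ... | true = frozen
  ... | false = oPlays over

module Certified (S : CellTrie 9) (closed : T (every (guarded S) S)) (start : T (emptyBoard ∈ᵗ S)) where

  guarded-member : ∀ b → T (b ∈ᵗ S) → T (guarded S b)
  guarded-member b = every-sound (guarded S) S b closed

  σO : Strategy
  σO _ b = prefer (_∈ᵗ S) b (moves O b)

  σO-legal : LegalFor O σO
  σO-legal h b canMove with moves O b
  ... | [] = ⊥-elim (canMove refl)
  ... | c ∷ cs = prefer-∈ (_∈ᵗ S) b c cs

  σO-recovers : ∀ h c → T (defended S c) →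
                hasLine X c ∨ hasLine O c ∨ isEmpty (moves O c) ≡ false → T (σO h c ∈ᵗ S)
  σO-recovers h c def over = prefer-sat (_∈ᵗ S) c (moves O c) someMoveInS
    where
      someMoveInS : T (any (_∈ᵗ S) (moves O c))
      someMoveInS = ∨-left (any (_∈ᵗ S) (moves O c)) (∧-right (not (hasLine X c)) def)
                           (∨-conicalʳ (hasLine X c) (hasLine O c ∨ isEmpty (moves O c)) over)

  data Invariant : State → Set where
    xToMove : ∀ {b h} → T (b ∈ᵗ S) → Invariant (X , b , h)
    oToMove : ∀ {c h} → T (defended S c) → Invariant (O , c , h)

  invariant-noWin : ∀ {s} → Invariant s → ¬ Wins X (proj₁ (proj₂ s))
  invariant-noWin (xToMove {b} member) = noWin b (∧-left (not (hasLine X b)) (guarded-member b member))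
  invariant-noWin (oToMove {c} def) = noWin c (∧-left (not (hasLine X c)) def)

  module _ (σX : Strategy) (σX-legal : LegalFor X σX) where

    σX-defended : ∀ h b → T (b ∈ᵗ S) →
                  hasLine X b ∨ hasLine O b ∨ isEmpty (moves X b) ≡ false → T (defended S (σX h b))
    σX-defended h b member over =
      All.lookup (all⁺ (defended S) (moves X b) everyMoveDefended) (σX-legal h b (nonEmpty (moves X b) canMove))
      where
        noLineO : hasLine O b ≡ false
        noLineO = proj₁ (continuing (hasLine X b) (hasLine O b) (isEmpty (moves X b)) over)
        canMove : isEmpty (moves X b) ≡ false
        canMove = proj₂ (continuing (hasLine X b) (hasLine O b) (isEmpty (moves X b)) over)
        everyMoveDefended : T (all (defended S) (moves X b))
        everyMoveDefended = ∨-right (hasLine O b) (∧-right (not (hasLine X b)) (guarded-member b member)) noLineO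

    preserve : ∀ {s s′} → Turn σX σO s s′ → Invariant s → Invariant s′
    preserve frozen inv = inv
    preserve (xPlays over) (xToMove {b} {h} member) = oToMove (σX-defended h b member over)
    preserve (oPlays over) (oToMove {c} {h} def) = xToMove (σO-recovers h c def over)

    invariant-run : ∀ n → Invariant (run σX σO n)
    invariant-run zero = xToMove start
    invariant-run (suc n) = preserve (turn σX σO (run σX σO n)) (invariant-run n)

    X-neverWins : ∀ n → ¬ Wins X (boardAt σX σO n)
    X-neverWins n with run σX σO n | invariant-run n
    ... | _ | inv = invariant-noWin inv

-- The concrete certificate (set of positions, X to move), with its closure
-- and its initial position verified by evaluation.  It is kept abstract so
-- that the rest of the development never unfolds it.
abstract
  safePositions : CellTrie 9
  safePositions =
    (node (node (node (node (node (node (node (node (node leaf ∅ ∅) ∅ ∅) ∅ ∅) ∅ ∅) ∅ ∅) (node ∅ ∅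
    (node ∅ (node ∅ ∅ (node ∅ (node ∅ ∅ leaf) ∅)) (node ∅ ∅ (node ∅ (node ∅ leaf ∅) ∅)))) (node ∅ ∅
    (node ∅ (node ∅ (node ∅ (node ∅ ∅ leaf) ∅) ∅) ∅))) (node (node ∅ (node ∅ (node ∅ ∅ (node ∅ ∅
    (node ∅ ∅ leaf))) ∅) (node ∅ (node ∅ ∅ (node ∅ (node ∅ ∅ leaf) ∅)) (node ∅ (node ∅ ∅ (node ∅
    leaf ∅)) ∅))) (node (node ∅ (node ∅ ∅ (node ∅ ∅ (node ∅ ∅ leaf))) ∅) (node ∅ ∅ (node ∅ ∅ (node
    (node ∅ ∅ leaf) ∅ ∅))) (node ∅ (node ∅ ∅ (node (node ∅ ∅ leaf) ∅ ∅)) (node ∅ ∅ (node ∅ (node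
    leaf ∅ ∅) ∅)))) (node ∅ (node ∅ (node ∅ ∅ (node (node ∅ ∅ leaf) ∅ ∅)) ∅) (node (node ∅ (node ∅
    (node ∅ ∅ leaf) ∅) ∅) (node (node ∅ (node ∅ ∅ leaf) ∅) (node (node ∅ ∅ leaf) ∅ ∅) ∅) (node (node
    ∅ (node ∅ leaf ∅) ∅) (node (node ∅ leaf ∅) (node leaf ∅ ∅) ∅) ∅)))) (node (node ∅ (node ∅ ∅
    (node ∅ (node ∅ (node ∅ ∅ leaf) ∅) ∅)) (node ∅ (node ∅ (node ∅ ∅ (node ∅ leaf ∅)) (node ∅ (node
    ∅ leaf ∅) ∅)) ∅)) (node (node ∅ ∅ (node ∅ (node ∅ (node ∅ ∅ leaf) ∅) ∅)) (node ∅ ∅ (node (node ∅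
    (node ∅ ∅ leaf) ∅) (node (node ∅ ∅ leaf) ∅ ∅) ∅)) (node (node ∅ (node ∅ ∅ (node ∅ leaf ∅)) (node
    ∅ (node ∅ leaf ∅) ∅)) (node (node ∅ ∅ (node ∅ leaf ∅)) (node ∅ ∅ (node leaf ∅ ∅)) (node (node ∅
    leaf ∅) (node leaf ∅ ∅) ∅)) ∅)) (node (node ∅ (node ∅ (node ∅ (node ∅ ∅ leaf) ∅) ∅) ∅) (node
    (node ∅ (node ∅ (node ∅ ∅ leaf) (node ∅ leaf ∅)) ∅) (node (node ∅ ∅ (node ∅ leaf ∅)) (node (node
    ∅ ∅ leaf) ∅ (node leaf ∅ ∅)) ∅) ∅) ∅))) (node (node (node ∅ (node ∅ (node ∅ ∅ (node ∅ ∅ (node ∅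
    ∅ leaf))) ∅) (node ∅ ∅ (node ∅ (node ∅ ∅ (node ∅ leaf ∅)) (node ∅ (node ∅ leaf ∅) ∅)))) (node
    (node ∅ (node ∅ ∅ (node ∅ ∅ (node ∅ ∅ leaf))) ∅) (node (node ∅ ∅ (node ∅ ∅ (node ∅ ∅ leaf))) ∅
    ∅) (node ∅ ∅ (node (node ∅ ∅ (node ∅ leaf ∅)) ∅ (node (node ∅ leaf ∅) (node leaf ∅ ∅) ∅))))
    (node (node ∅ ∅ (node ∅ (node ∅ ∅ (node ∅ leaf ∅)) ∅)) (node ∅ (node (node ∅ ∅ (node ∅ ∅ leaf))
    ∅ ∅) ∅) (node (node ∅ (node ∅ (node ∅ ∅ leaf) (node ∅ leaf ∅)) ∅) (node (node ∅ (node ∅ ∅ leaf)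
    ∅) (node (node ∅ ∅ leaf) ∅ (node leaf ∅ ∅)) ∅) (node (node ∅ (node ∅ leaf ∅) ∅) (node (node ∅
    leaf ∅) (node leaf ∅ ∅) ∅) ∅)))) (node (node (node ∅ (node ∅ ∅ (node ∅ ∅ (node ∅ ∅ leaf))) ∅)
    (node (node ∅ ∅ (node ∅ ∅ (node ∅ ∅ leaf))) ∅ ∅) (node (node ∅ ∅ (node ∅ (node ∅ ∅ leaf) ∅)) ∅
    (node ∅ ∅ (node (node ∅ leaf ∅) (node leaf ∅ ∅) ∅)))) (node (node (node ∅ ∅ (node ∅ ∅ (node ∅ ∅
    leaf))) ∅ ∅) ∅ ∅) (node (node ∅ ∅ (node (node ∅ ∅ (node ∅ leaf ∅)) ∅ ∅)) ∅ (node (node (node ∅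
    (node ∅ ∅ leaf) ∅) (node ∅ ∅ (node leaf ∅ ∅)) ∅) ∅ (node (node (node ∅ leaf ∅) (node leaf ∅ ∅)
    ∅) (node (node leaf ∅ ∅) ∅ ∅) ∅)))) (node (node ∅ (node (node ∅ (node ∅ ∅ (node ∅ ∅ leaf)) ∅) ∅
    ∅) (node (node ∅ ∅ (node ∅ (node ∅ leaf ∅) ∅)) (node (node ∅ ∅ (node ∅ leaf ∅)) (node ∅ ∅ (node
    leaf ∅ ∅)) (node (node ∅ leaf ∅) (node leaf ∅ ∅) ∅)) ∅)) (node (node ∅ ∅ (node ∅ (node (node ∅ ∅
    leaf) ∅ ∅) ∅)) (node ∅ ∅ (node (node (node ∅ ∅ leaf) ∅ ∅) ∅ ∅)) (node (node (node ∅ ∅ (node ∅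
    leaf ∅)) ∅ (node (node ∅ leaf ∅) (node leaf ∅ ∅) ∅)) (node (node ∅ ∅ (node leaf ∅ ∅)) ∅ (node
    (node leaf ∅ ∅) ∅ ∅)) ∅)) (node (node (node ∅ (node ∅ ∅ (node ∅ leaf ∅)) ∅) (node ∅ (node (node
    ∅ ∅ leaf) ∅ ∅) ∅) ∅) (node (node ∅ (node ∅ ∅ (node leaf ∅ ∅)) ∅) (node (node ∅ ∅ (node leaf ∅
    ∅)) ∅ ∅) ∅) (node (node (node ∅ (node ∅ leaf ∅) ∅) (node (node ∅ leaf ∅) (node leaf ∅ ∅) ∅) ∅)
    (node (node (node ∅ leaf ∅) (node leaf ∅ ∅) ∅) (node (node leaf ∅ ∅) ∅ ∅) ∅) ∅)))) (node (node
    (node ∅ (node ∅ ∅ (node ∅ (node ∅ ∅ (node ∅ leaf ∅)) (node ∅ (node ∅ leaf ∅) ∅))) (node ∅ (node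
    ∅ (node ∅ ∅ (node ∅ leaf ∅)) ∅) ∅)) (node (node ∅ ∅ (node ∅ (node ∅ ∅ (node ∅ leaf ∅)) ∅)) (node
    ∅ ∅ (node (node ∅ (node ∅ ∅ leaf) ∅) ∅ (node ∅ (node leaf ∅ ∅) ∅))) (node (node ∅ (node ∅ ∅
    (node ∅ leaf ∅)) ∅) (node (node ∅ ∅ (node ∅ leaf ∅)) (node ∅ ∅ (node leaf ∅ ∅)) (node (node ∅
    leaf ∅) (node leaf ∅ ∅) ∅)) ∅)) (node (node ∅ (node ∅ (node ∅ ∅ (node ∅ leaf ∅)) ∅) ∅) (node
    (node ∅ (node ∅ (node ∅ ∅ leaf) (node ∅ leaf ∅)) ∅) (node (node ∅ (node ∅ ∅ leaf) ∅) ∅ ∅) ∅) ∅))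
    (node (node (node ∅ (node ∅ ∅ (node ∅ (node ∅ ∅ leaf) ∅)) (node ∅ ∅ (node ∅ (node ∅ leaf ∅) ∅)))
    (node (node ∅ ∅ (node ∅ (node ∅ ∅ leaf) ∅)) (node ∅ ∅ (node (node ∅ ∅ leaf) ∅ ∅)) (node (node ∅
    ∅ (node ∅ leaf ∅)) ∅ (node (node ∅ leaf ∅) (node leaf ∅ ∅) ∅))) (node (node ∅ (node ∅ ∅ (node ∅
    leaf ∅)) ∅) (node ∅ (node ∅ ∅ (node leaf ∅ ∅)) ∅) ∅)) (node (node (node ∅ ∅ (node ∅ (node ∅ ∅
    leaf) ∅)) ∅ (node (node ∅ ∅ (node ∅ leaf ∅)) ∅ (node (node ∅ leaf ∅) ∅ ∅))) (node ∅ ∅ (node ∅ ∅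
    (node (node leaf ∅ ∅) ∅ ∅))) (node (node (node ∅ (node ∅ ∅ leaf) (node ∅ leaf ∅)) (node ∅ ∅
    (node leaf ∅ ∅)) (node ∅ (node leaf ∅ ∅) ∅)) (node (node ∅ ∅ (node leaf ∅ ∅)) ∅ (node (node leaf
    ∅ ∅) ∅ ∅)) (node (node (node ∅ leaf ∅) (node leaf ∅ ∅) ∅) (node (node leaf ∅ ∅) ∅ ∅) ∅))) (node
    ∅ (node ∅ (node (node (node ∅ ∅ leaf) ∅ ∅) ∅ ∅) (node (node (node ∅ leaf ∅) ∅ ∅) ∅ ∅)) (node
    (node ∅ (node (node ∅ leaf ∅) ∅ ∅) ∅) ∅ ∅))) (node (node (node ∅ (node ∅ (node ∅ ∅ (node ∅ leaf
    ∅)) ∅) ∅) (node ∅ (node (node ∅ ∅ (node ∅ leaf ∅)) ∅ ∅) ∅) ∅) ∅ ∅))) (node (node (node (node ∅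
    (node ∅ (node ∅ ∅ (node ∅ ∅ (node ∅ ∅ leaf))) ∅) (node ∅ ∅ (node ∅ ∅ (node ∅ (node ∅ leaf ∅)
    ∅)))) (node (node ∅ (node ∅ ∅ (node ∅ ∅ (node ∅ ∅ leaf))) ∅) (node ∅ ∅ (node ∅ ∅ (node (node ∅ ∅
    leaf) ∅ ∅))) (node (node ∅ ∅ (node ∅ (node ∅ ∅ leaf) ∅)) (node ∅ ∅ (node (node ∅ ∅ leaf) ∅ ∅))
    (node ∅ ∅ (node (node ∅ leaf ∅) (node leaf ∅ ∅) ∅)))) (node ∅ (node ∅ (node ∅ ∅ (node (node ∅ ∅
    leaf) ∅ ∅)) ∅) (node (node ∅ (node ∅ (node ∅ ∅ leaf) (node ∅ leaf ∅)) ∅) (node (node ∅ (node ∅ ∅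
    leaf) ∅) ∅ ∅) (node (node ∅ (node ∅ leaf ∅) ∅) (node (node ∅ leaf ∅) (node leaf ∅ ∅) ∅) ∅))))
    (node (node (node ∅ (node ∅ ∅ (node ∅ ∅ (node ∅ ∅ leaf))) ∅) (node (node ∅ ∅ (node ∅ ∅ (node ∅ ∅
    leaf))) ∅ ∅) (node ∅ ∅ (node ∅ ∅ (node (node ∅ leaf ∅) (node leaf ∅ ∅) ∅)))) (node (node (node ∅
    ∅ (node ∅ ∅ (node ∅ ∅ leaf))) ∅ ∅) ∅ ∅) (node (node (node ∅ ∅ (node ∅ (node ∅ ∅ leaf) ∅)) ∅ ∅) ∅
    (node (node (node ∅ (node ∅ ∅ leaf) ∅) (node (node ∅ ∅ leaf) ∅ ∅) ∅) ∅ (node (node (node ∅ leaf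
    ∅) (node leaf ∅ ∅) ∅) (node (node leaf ∅ ∅) ∅ ∅) ∅)))) (node (node (node ∅ ∅ (node ∅ (node ∅
    (node ∅ ∅ leaf) ∅) ∅)) (node ∅ ∅ (node (node ∅ (node ∅ ∅ leaf) ∅) (node (node ∅ ∅ leaf) ∅ ∅) ∅))
    (node (node ∅ ∅ (node ∅ (node ∅ leaf ∅) ∅)) (node (node ∅ ∅ (node ∅ leaf ∅)) ∅ (node (node ∅
    leaf ∅) (node leaf ∅ ∅) ∅)) ∅)) (node (node ∅ ∅ (node (node ∅ (node ∅ ∅ leaf) ∅) ∅ ∅)) (node ∅ ∅
    (node (node (node ∅ ∅ leaf) ∅ ∅) ∅ ∅)) (node (node ∅ ∅ (node (node ∅ leaf ∅) (node leaf ∅ ∅) ∅))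
    (node ∅ ∅ (node (node leaf ∅ ∅) ∅ ∅)) (node (node (node ∅ leaf ∅) ∅ ∅) ∅ ∅))) (node (node (node
    ∅ (node ∅ (node ∅ ∅ leaf) ∅) ∅) (node (node ∅ (node ∅ ∅ leaf) ∅) (node (node ∅ ∅ leaf) ∅ ∅) ∅)
    ∅) (node (node ∅ (node (node ∅ ∅ leaf) ∅ (node leaf ∅ ∅)) ∅) (node (node (node ∅ ∅ leaf) ∅ ∅) ∅
    ∅) ∅) (node (node ∅ (node (node ∅ leaf ∅) ∅ ∅) ∅) (node (node (node ∅ leaf ∅) (node leaf ∅ ∅) ∅)
    ∅ ∅) ∅)))) (node (node (node (node ∅ (node ∅ ∅ (node ∅ ∅ (node ∅ ∅ leaf))) ∅) (node (node ∅ ∅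
    (node ∅ ∅ (node ∅ ∅ leaf))) ∅ ∅) (node (node ∅ ∅ (node ∅ (node ∅ ∅ leaf) ∅)) ∅ ∅)) (node (node
    (node ∅ ∅ (node ∅ ∅ (node ∅ ∅ leaf))) ∅ ∅) ∅ ∅) (node ∅ ∅ (node (node (node ∅ (node ∅ ∅ leaf) ∅)
    (node (node ∅ ∅ leaf) ∅ (node leaf ∅ ∅)) ∅) ∅ (node (node (node ∅ leaf ∅) (node leaf ∅ ∅) ∅)
    (node (node leaf ∅ ∅) ∅ ∅) ∅)))) ∅ (node (node (node ∅ ∅ (node (node ∅ (node ∅ ∅ leaf) ∅) (node
    (node ∅ ∅ leaf) ∅ ∅) ∅)) (node (node (node ∅ ∅ (node ∅ ∅ leaf)) ∅ ∅) ∅ ∅) (node (node (node ∅ ∅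
    (node ∅ leaf ∅)) ∅ (node (node ∅ leaf ∅) (node leaf ∅ ∅) ∅)) (node (node (node ∅ ∅ leaf) ∅ (node
    leaf ∅ ∅)) ∅ (node (node leaf ∅ ∅) ∅ ∅)) ∅)) (node (node ∅ ∅ (node (node (node ∅ ∅ leaf) ∅ ∅) ∅
    ∅)) ∅ ∅) (node (node ∅ (node (node (node ∅ ∅ leaf) ∅ ∅) ∅ ∅) ∅) ∅ ∅))) (node (node (node (node
    (node (node (node leaf ∅ ∅) ∅ ∅) ∅ ∅) (node ∅ ∅ (node ∅ (node ∅ ∅ leaf) ∅)) ∅) (node (node (node
    (node ∅ ∅ leaf) ∅ ∅) ∅ (node ∅ (node ∅ ∅ leaf) ∅)) ∅ ∅) (node (node (node (node ∅ leaf ∅) ∅ ∅)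
    (node ∅ ∅ (node ∅ leaf ∅)) ∅) (node (node ∅ (node ∅ ∅ leaf) (node ∅ leaf ∅)) (node (node ∅ ∅
    leaf) ∅ (node leaf ∅ ∅)) ∅) (node ∅ (node (node ∅ leaf ∅) ∅ ∅) ∅))) (node (node (node ∅ ∅ (node
    (node leaf ∅ ∅) (node ∅ ∅ leaf) ∅)) ∅ ∅) (node (node ∅ ∅ (node (node ∅ ∅ leaf) ∅ (node leaf ∅
    ∅))) ∅ (node ∅ ∅ (node (node leaf ∅ ∅) ∅ ∅))) (node (node (node ∅ ∅ (node ∅ leaf ∅)) ∅ (node
    (node ∅ leaf ∅) (node leaf ∅ ∅) ∅)) (node (node (node ∅ ∅ leaf) ∅ (node leaf ∅ ∅)) ∅ (node (node
    leaf ∅ ∅) ∅ ∅)) ∅)) (node (node (node (node ∅ (node leaf ∅ ∅) ∅) (node (node leaf ∅ ∅) (node ∅ ∅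
    leaf) ∅) ∅) (node (node (node leaf ∅ ∅) ∅ ∅) (node (node ∅ ∅ leaf) ∅ (node leaf ∅ ∅)) ∅) ∅)
    (node (node (node ∅ (node ∅ ∅ leaf) ∅) (node (node ∅ ∅ leaf) ∅ (node leaf ∅ ∅)) ∅) (node (node
    (node ∅ ∅ leaf) ∅ ∅) ∅ ∅) (node ∅ (node (node leaf ∅ ∅) ∅ ∅) ∅)) (node (node (node ∅ (node ∅
    leaf ∅) ∅) (node (node ∅ leaf ∅) (node leaf ∅ ∅) ∅) ∅) (node (node (node ∅ leaf ∅) (node leaf ∅
    ∅) ∅) (node (node leaf ∅ ∅) ∅ ∅) ∅) ∅))) (node (node (node (node ∅ ∅ (node ∅ (node ∅ ∅ leaf) ∅))
    ∅ ∅) (node (node ∅ ∅ (node (node ∅ ∅ leaf) ∅ ∅)) ∅ ∅) (node (node (node ∅ ∅ (node ∅ leaf ∅))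
    (node ∅ ∅ (node leaf ∅ ∅)) ∅) (node (node (node ∅ ∅ leaf) ∅ (node leaf ∅ ∅)) ∅ ∅) ∅)) (node
    (node ∅ ∅ (node ∅ ∅ (node (node leaf ∅ ∅) ∅ ∅))) ∅ (node (node (node (node ∅ ∅ leaf) ∅ (node
    leaf ∅ ∅)) ∅ (node (node leaf ∅ ∅) ∅ ∅)) ∅ ∅)) (node (node (node (node (node leaf ∅ ∅) ∅ ∅) ∅ ∅)
    (node (node (node ∅ ∅ leaf) ∅ ∅) ∅ ∅) ∅) (node (node (node (node ∅ ∅ leaf) ∅ ∅) ∅ ∅) ∅ (node
    (node (node leaf ∅ ∅) ∅ ∅) ∅ ∅)) (node (node (node (node ∅ leaf ∅) (node leaf ∅ ∅) ∅) (node
    (node leaf ∅ ∅) ∅ ∅) ∅) (node (node (node leaf ∅ ∅) ∅ ∅) ∅ ∅) ∅))) (node (node ∅ (node (node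
    (node ∅ (node ∅ ∅ leaf) ∅) ∅ ∅) ∅ ∅) (node (node (node ∅ (node ∅ leaf ∅) ∅) ∅ ∅) ∅ ∅)) ∅ ∅)))
    (node (node (node (node (node (node (node (node ∅ leaf ∅) (node leaf ∅ ∅) ∅) (node (node leaf ∅
    ∅) (node ∅ ∅ leaf) (node ∅ leaf ∅)) (node ∅ (node ∅ leaf ∅) ∅)) (node (node (node leaf ∅ ∅) ∅ ∅)
    ∅ ∅) ∅) (node (node (node (node leaf ∅ ∅) ∅ ∅) ∅ ∅) ∅ (node ∅ (node ∅ (node ∅ ∅ leaf) (node ∅
    leaf ∅)) (node ∅ (node ∅ leaf ∅) ∅))) (node ∅ (node (node ∅ (node leaf ∅ ∅) ∅) (node ∅ (node ∅ ∅
    leaf) ∅) ∅) ∅)) (node (node (node (node (node leaf ∅ ∅) ∅ ∅) ∅ ∅) ∅ (node ∅ ∅ (node ∅ (node ∅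
    leaf ∅) ∅))) (node ∅ ∅ (node (node (node leaf ∅ ∅) ∅ (node ∅ leaf ∅)) (node ∅ ∅ (node leaf ∅ ∅))
    (node (node ∅ leaf ∅) ∅ ∅))) (node (node (node ∅ (node leaf ∅ ∅) ∅) (node ∅ (node ∅ ∅ leaf) ∅)
    (node ∅ (node ∅ leaf ∅) ∅)) (node (node (node leaf ∅ ∅) (node ∅ ∅ leaf) ∅) (node (node ∅ ∅ leaf)
    ∅ ∅) ∅) ∅)) (node (node ∅ (node ∅ ∅ (node ∅ (node ∅ leaf ∅) ∅)) ∅) (node (node ∅ ∅ (node ∅ (node
    ∅ leaf ∅) ∅)) (node (node (node leaf ∅ ∅) ∅ ∅) ∅ (node (node ∅ leaf ∅) (node leaf ∅ ∅) ∅)) ∅)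
    ∅)) (node (node (node (node (node (node leaf ∅ ∅) ∅ ∅) ∅ ∅) (node (node (node ∅ ∅ leaf) ∅ ∅) ∅
    ∅) (node (node (node ∅ leaf ∅) ∅ ∅) ∅ (node ∅ (node ∅ leaf ∅) ∅))) (node (node ∅ ∅ (node (node
    leaf ∅ ∅) ∅ ∅)) (node (node ∅ ∅ (node ∅ ∅ leaf)) ∅ ∅) (node (node ∅ ∅ (node ∅ leaf ∅)) ∅ (node
    (node ∅ leaf ∅) ∅ ∅))) (node (node (node ∅ (node leaf ∅ ∅) ∅) (node (node leaf ∅ ∅) (node ∅ ∅
    leaf) (node ∅ leaf ∅)) ∅) (node (node ∅ (node ∅ ∅ leaf) ∅) (node (node ∅ ∅ leaf) ∅ (node leaf ∅
    ∅)) ∅) (node (node ∅ (node ∅ leaf ∅) ∅) (node (node ∅ leaf ∅) (node leaf ∅ ∅) ∅) ∅))) (node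
    (node ∅ ∅ (node ∅ ∅ (node (node ∅ leaf ∅) (node leaf ∅ ∅) ∅))) (node ∅ ∅ (node ∅ ∅ (node (node
    leaf ∅ ∅) ∅ ∅))) (node (node (node (node leaf ∅ ∅) (node ∅ ∅ leaf) ∅) (node (node ∅ ∅ leaf) ∅
    (node leaf ∅ ∅)) ∅) (node (node (node ∅ ∅ leaf) ∅ ∅) ∅ ∅) (node (node (node ∅ leaf ∅) (node leaf
    ∅ ∅) ∅) (node (node leaf ∅ ∅) ∅ ∅) ∅))) (node (node (node ∅ ∅ (node ∅ (node ∅ leaf ∅) ∅)) (node
    ∅ ∅ (node ∅ (node leaf ∅ ∅) ∅)) ∅) (node (node ∅ ∅ (node (node ∅ leaf ∅) (node leaf ∅ ∅) ∅))
    (node ∅ ∅ (node (node leaf ∅ ∅) ∅ ∅)) ∅) (node ∅ (node ∅ (node (node leaf ∅ ∅) ∅ ∅) ∅) ∅)))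
    (node (node (node ∅ (node (node (node ∅ leaf ∅) ∅ ∅) (node (node leaf ∅ ∅) ∅ (node ∅ leaf ∅)) ∅)
    ∅) (node (node (node (node ∅ leaf ∅) ∅ ∅) (node (node leaf ∅ ∅) ∅ (node ∅ leaf ∅)) ∅) (node
    (node ∅ ∅ (node ∅ leaf ∅)) ∅ ∅) ∅) ∅) (node ∅ (node (node ∅ (node ∅ ∅ (node leaf ∅ ∅)) ∅) ∅ ∅)
    ∅) (node ∅ (node ∅ (node ∅ (node (node leaf ∅ ∅) ∅ ∅) ∅) ∅) ∅))) (node (node (node (node (node
    (node (node leaf ∅ ∅) ∅ ∅) ∅ ∅) ∅ ∅) (node (node (node ∅ ∅ (node leaf ∅ ∅)) ∅ (node ∅ ∅ (node ∅
    leaf ∅))) ∅ (node (node ∅ ∅ (node ∅ leaf ∅)) ∅ ∅)) (node (node (node ∅ (node leaf ∅ ∅) ∅) (node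
    ∅ (node ∅ ∅ leaf) ∅) ∅) (node (node (node leaf ∅ ∅) (node ∅ ∅ leaf) ∅) (node (node ∅ ∅ leaf) ∅
    (node leaf ∅ ∅)) ∅) ∅)) (node (node ∅ ∅ (node ∅ ∅ (node (node ∅ leaf ∅) ∅ ∅))) (node ∅ ∅ (node
    (node ∅ ∅ (node leaf ∅ ∅)) ∅ ∅)) (node (node (node (node leaf ∅ ∅) (node ∅ ∅ leaf) (node ∅ leaf
    ∅)) (node (node ∅ ∅ leaf) ∅ (node leaf ∅ ∅)) ∅) (node (node (node ∅ ∅ leaf) ∅ (node leaf ∅ ∅)) ∅
    ∅) (node (node (node ∅ leaf ∅) (node leaf ∅ ∅) ∅) (node (node leaf ∅ ∅) ∅ ∅) ∅))) (node (node
    (node ∅ ∅ (node ∅ (node ∅ leaf ∅) ∅)) (node ∅ ∅ (node (node ∅ leaf ∅) ∅ ∅)) ∅) (node (node ∅ ∅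
    (node (node ∅ leaf ∅) ∅ ∅)) (node (node ∅ ∅ (node leaf ∅ ∅)) ∅ (node (node leaf ∅ ∅) ∅ ∅)) ∅)
    ∅)) (node (node ∅ (node (node ∅ ∅ (node ∅ ∅ (node leaf ∅ ∅))) ∅ (node (node ∅ ∅ (node leaf ∅ ∅))
    ∅ (node (node leaf ∅ ∅) ∅ ∅))) (node (node (node ∅ (node ∅ ∅ leaf) ∅) (node (node ∅ ∅ leaf) ∅
    (node leaf ∅ ∅)) ∅) (node (node (node ∅ ∅ leaf) ∅ ∅) ∅ ∅) ∅)) (node (node ∅ ∅ (node ∅ ∅ (node
    (node leaf ∅ ∅) ∅ ∅))) ∅ (node (node (node (node ∅ ∅ leaf) ∅ (node leaf ∅ ∅)) ∅ (node (node leaf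
    ∅ ∅) ∅ ∅)) ∅ ∅)) (node (node (node (node (node leaf ∅ ∅) ∅ ∅) ∅ (node (node ∅ leaf ∅) (node leaf
    ∅ ∅) ∅)) (node ∅ ∅ (node (node leaf ∅ ∅) ∅ ∅)) (node (node (node ∅ leaf ∅) ∅ ∅) ∅ ∅)) (node
    (node (node (node ∅ ∅ leaf) ∅ (node leaf ∅ ∅)) ∅ (node (node leaf ∅ ∅) ∅ ∅)) ∅ ∅) (node (node ∅
    (node (node leaf ∅ ∅) ∅ ∅) ∅) ∅ ∅))) (node (node (node (node (node (node ∅ leaf ∅) ∅ ∅) (node
    (node leaf ∅ ∅) ∅ (node ∅ leaf ∅)) ∅) (node (node ∅ ∅ (node ∅ leaf ∅)) (node ∅ ∅ (node leaf ∅
    ∅)) ∅) ∅) (node (node (node ∅ ∅ (node ∅ leaf ∅)) (node ∅ ∅ (node leaf ∅ ∅)) ∅) ∅ ∅) (node (node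
    (node ∅ (node ∅ leaf ∅) ∅) (node ∅ (node leaf ∅ ∅) ∅) ∅) (node (node (node ∅ leaf ∅) ∅ ∅) ∅ ∅)
    ∅)) (node (node (node (node ∅ ∅ (node ∅ leaf ∅)) (node ∅ ∅ (node leaf ∅ ∅)) ∅) ∅ ∅) ∅ (node
    (node ∅ (node (node leaf ∅ ∅) ∅ ∅) ∅) ∅ ∅)) (node (node (node ∅ (node (node ∅ leaf ∅) ∅ ∅) ∅) ∅
    ∅) ∅ ∅))) (node (node (node ∅ (node (node (node ∅ (node leaf ∅ ∅) ∅) ∅ ∅) ∅ ∅) (node ∅ (node
    (node ∅ (node ∅ leaf ∅) ∅) ∅ ∅) ∅)) (node (node (node (node (node ∅ leaf ∅) ∅ ∅) (node (node
    leaf ∅ ∅) ∅ (node ∅ leaf ∅)) ∅) ∅ ∅) (node (node ∅ (node (node ∅ ∅ leaf) ∅ (node leaf ∅ ∅)) ∅) ∅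
    (node (node (node ∅ leaf ∅) (node leaf ∅ ∅) ∅) (node (node leaf ∅ ∅) ∅ ∅) ∅)) (node ∅ (node
    (node (node ∅ leaf ∅) ∅ ∅) ∅ ∅) ∅)) ∅) (node (node ∅ (node (node ∅ ∅ (node ∅ (node leaf ∅ ∅) ∅))
    ∅ ∅) (node (node ∅ (node (node ∅ leaf ∅) (node leaf ∅ ∅) ∅) ∅) ∅ ∅)) (node (node (node ∅ ∅ (node
    (node ∅ leaf ∅) ∅ ∅)) ∅ ∅) ∅ (node (node ∅ (node (node leaf ∅ ∅) ∅ ∅) ∅) ∅ ∅)) ∅) (node (node
    (node ∅ (node (node ∅ (node ∅ leaf ∅) ∅) (node (node ∅ leaf ∅) (node leaf ∅ ∅) ∅) ∅) ∅) (node
    (node (node ∅ (node ∅ leaf ∅) ∅) (node (node ∅ leaf ∅) (node leaf ∅ ∅) ∅) ∅) (node (node (node ∅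
    leaf ∅) (node leaf ∅ ∅) ∅) (node (node leaf ∅ ∅) ∅ ∅) ∅) ∅) ∅) (node (node (node (node ∅ (node ∅
    leaf ∅) ∅) (node (node ∅ leaf ∅) (node leaf ∅ ∅) ∅) ∅) (node (node (node ∅ leaf ∅) (node leaf ∅
    ∅) ∅) (node (node leaf ∅ ∅) ∅ ∅) ∅) ∅) (node (node (node (node ∅ leaf ∅) (node leaf ∅ ∅) ∅)
    (node (node leaf ∅ ∅) ∅ ∅) ∅) ∅ ∅) ∅) ∅))))

  safePositions-closed : T (every (guarded safePositions) safePositions)
  safePositions-closed = tt

  safePositions-start : T (emptyBoard ∈ᵗ safePositions)
  safePositions-start = tt

theorem2p9 : ∃ λ (σO : Strategy) → LegalFor O σO ×
               ((σX : Strategy) → LegalFor X σX → (n : ℕ) → ¬ Wins X (boardAt σX σO n))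
theorem2p9 = σO , σO-legal , X-neverWins
  where open Certified safePositions safePositions-closed safePositions-start
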